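{- Let $BF(r)$ be the $r$-dimensional butterfly network with $r\geq 3$. Then $SSPC_{2U}(BF(r))\leq \left\lceil \frac{r}{2}\right\rceil 2^{r-1}$.
   Context: The $r$-dimensional butterfly network $BF(r)$ has vertex set $\{[w,i]: w\in\{0,1\}^r,\ 0\leq i\leq r\}$, and $[w,i]$ is adjacent to $[w',i+1]$ iff $w'=w$ or $w$ and $w'$ differ exactly in the $(i+1)$-th bit; there are no other edges. For a graph $G$ with distance $d$, a set $S\subseteq V(G)$ is a $2$-strong shortest path union cover if one can choose, for each $u\in S$ and each $v\in V(G)$ with $d(u,v)\leq 2$, a single shortest $u$–$v$ path $P(u,v)$ such that the union of the edge sets of all chosen paths equals $E(G)$; $SSPC_{2U}(G)$ is the minimum cardinality of such a set. -}

module Defs where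

open import Data.Nat using (ℕ; zero; suc; _≤_)
open import Data.Bool using (Bool; not)
open import Data.Fin using (Fin; zero; suc; inject₁)
open import Data.Vec using (Vec; _[_]%=_)
open import Data.Product using (Σ; _×_; _,_)
open import Data.Sum using (_⊎_)
open import Data.Empty using (⊥)
open import Data.List using (List; length)
open import Data.List.Membership.Propositional using (_∈_)
open import Data.List.Relation.Unary.Unique.Propositional using (Unique)
open import Relation.Binary.PropositionalEquality using (_≡_)

BFVertex : ℕ → Set
BFVertex r = Vec Bool r × Fin (suc r)

-- flip the bit at 0-indexed position i (= the (i+1)-th bit)
flipBit : ∀ {r} → Vec Bool r → Fin r → Vec Bool r
flipBit w i = w [ i ]%= not

data Link (r : ℕ) : BFVertex r → BFVertex r → Set where
  straight : (w : Vec Bool r) (i : Fin r) → Link r (w , inject₁ i) (w , suc i)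
  cross    : (w : Vec Bool r) (i : Fin r) → Link r (w , inject₁ i) (flipBit w i , suc i)

Adj : (r : ℕ) → BFVertex r → BFVertex r → Set
Adj r x y = Link r x y ⊎ Link r y x

data Walk (r : ℕ) : BFVertex r → BFVertex r → Set where
  []  : ∀ {u} → Walk r u u
  _∷_ : ∀ {u w v} → Adj r u w → Walk r w v → Walk r u v

walkLength : ∀ {r u v} → Walk r u v → ℕ
walkLength []      = zero
walkLength (_ ∷ p) = suc (walkLength p)

DistLe2 : (r : ℕ) → BFVertex r → BFVertex r → Set
DistLe2 r u v = Σ (Walk r u v) (λ p → walkLength p ≤ 2)

IsShortest : ∀ {r u v} → Walk r u v → Set
IsShortest {r} {u} {v} p = (q : Walk r u v) → walkLength p ≤ walkLength q

EdgeOn : ∀ {r u v} → BFVertex r → BFVertex r → Walk r u v → Set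
EdgeOn x y [] = ⊥
EdgeOn x y (_∷_ {u = a} {w = b} _ p) = ((a ≡ x × b ≡ y) ⊎ (a ≡ y × b ≡ x)) ⊎ EdgeOn x y p

-- S is a 2-strong shortest path union cover of BF(r): a choice of a single
-- shortest path P(u,v) for each u ∈ S and v with d(u,v) ≤ 2 (the proofs of
-- membership and of d(u,v) ≤ 2 are irrelevant, so P(u,v) is one path per
-- pair), such that every edge of BF(r) lies on some chosen path.
-- (Chosen paths consist of edges of BF(r), so the union is ⊆ E automatically.)
record Is2SSPUnionCover (r : ℕ) (S : List (BFVertex r)) : Set where
  field
    path     : (u v : BFVertex r) → .(u ∈ S) → .(DistLe2 r u v) → Walk r u v
    shortest : (u v : BFVertex r) (m : u ∈ S) (h : DistLe2 r u v) →
               IsShortest (path u v m h)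
    covers   : (x y : BFVertex r) → Adj r x y →
               Σ (BFVertex r) λ u → Σ (u ∈ S) λ m →
               Σ (BFVertex r) λ v → Σ (DistLe2 r u v) λ h →
               EdgeOn x y (path u v m h)

module Submission where

-- A layer is the set of the 2^(r-1) vertices of a level p + 1 whose bits p and p + 1 have a
-- prescribed parity. Between vertices two levels apart the shortest path is unique (its middle
-- vertex is forced), so every shortest path from a layer vertex to a vertex two levels higher
-- (lower) runs through the link between levels p + 2 and p + 3 (p - 1 and p) that it ends with;
-- since the free bit of a layer vertex can be flipped to fix the parity, every such link is
-- reached. Hence one layer covers two link levels three apart, and the two layers of level p + 1
-- (the whole level) cover the four link levels p - 1, ..., p + 2. For r = 3, 4, 5, 6 one checks
-- directly that ⌈r/2⌉ layers cover all r link levels (for r = 6 by single layers on the pairs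
-- {0,3}, {1,4}, {2,5}), and each further four link levels cost one whole level, i.e. two layers.

open import Defs
open import Data.Nat using (ℕ; zero; suc; _+_; _*_; _^_; _∸_; _≤_; _<_; z≤n; s≤s; ⌈_/2⌉; _≟_; _≤?_)
open import Data.Nat.Properties
  using (suc-injective; ≤-refl; ≤-trans; ≤-reflexive; m≤n⇒m≤1+n; m<1+n⇒m<n∨m≡n; m<1+n⇒m≤n; ≰⇒>;
         <-≤-connex; n≤1+n; m≤m+n; m≤n+m; m≢1+n+m; m∸n+n≡m; m≤n+o⇒m∸n≤o; +-comm; +-identityʳ;
         +-monoʳ-≤; *-monoˡ-≤)
open import Data.Bool using (Bool; true; false; not; _xor_)
import Data.Bool.Properties as Bool
open import Data.Fin using (Fin; zero; suc; toℕ; inject₁; fromℕ<)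
open import Data.Fin.Properties using (toℕ-injective; toℕ-inject₁; toℕ-fromℕ<; toℕ<n)
import Data.Fin.Properties as Fin
open import Data.Vec using (Vec; []; _∷_)
import Data.Vec.Properties as Vec
open import Data.List
  using (List; []; _∷_; [_]; _++_; map; length; concatMap; cartesianProduct; allFin; deduplicate)
open import Data.List.Properties using (length-++; length-map; length-deduplicate)
open import Data.List.Membership.Propositional using (_∈_; lose)
open import Data.List.Membership.Propositional.Properties
  using (∈-++⁺ˡ; ∈-++⁺ʳ; ∈-++⁻; ∈-map⁺; ∈-concatMap⁺; ∈-cartesianProduct⁺; ∈-allFin; ∈-deduplicate⁺)
open import Data.List.Relation.Unary.Any using (here; there; any?; satisfied)
open import Data.List.Relation.Unary.Unique.Propositional using (Unique)
open import Data.List.Relation.Unary.Unique.DecPropositional.Properties using (deduplicate-!)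
open import Data.Product using (Σ; _×_; _,_)
import Data.Product.Properties as Product
open import Data.Sum using (_⊎_; inj₁; inj₂; [_,_]′) renaming (swap to ⊎-swap)
open import Data.Empty using (⊥-elim)
import Data.Empty.Irrelevant as Irrelevant
open import Function using (_∘_)
open import Relation.Nullary using (¬_; Dec; yes; no)
open import Relation.Nullary.Decidable using (_⊎-dec_; _×-dec_)
open import Relation.Binary.Definitions using (DecidableEquality)
open import Relation.Binary.PropositionalEquality
  using (_≡_; _≢_; refl; sym; trans; cong; cong₂; subst; module ≡-Reasoning)

-- Bit positions are natural numbers, as levels are; out of range every bit reads false.
bit : ∀ {n} → Vec Bool n → ℕ → Bool
bit []      _       = false
bit (b ∷ _) zero    = b
bit (_ ∷ w) (suc t) = bit w t

bit-ext : ∀ {n} {v w : Vec Bool n} → (∀ t → bit v t ≡ bit w t) → v ≡ w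
bit-ext {v = []}    {[]}    _  = refl
bit-ext {v = _ ∷ _} {_ ∷ _} eq = cong₂ _∷_ (eq zero) (bit-ext (eq ∘ suc))

bit-flipBit-≡ : ∀ {n} (v : Vec Bool n) (i : Fin n) → bit (flipBit v i) (toℕ i) ≡ not (bit v (toℕ i))
bit-flipBit-≡ (_ ∷ _) zero    = refl
bit-flipBit-≡ (_ ∷ v) (suc i) = bit-flipBit-≡ v i

bit-flipBit-≢ : ∀ {n} (v : Vec Bool n) (i : Fin n) {t} → t ≢ toℕ i → bit (flipBit v i) t ≡ bit v t
bit-flipBit-≢ (_ ∷ _) zero    {zero}  t≢i = ⊥-elim (t≢i refl)
bit-flipBit-≢ (_ ∷ _) zero    {suc t} _   = refl
bit-flipBit-≢ (_ ∷ _) (suc i) {zero}  _   = refl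
bit-flipBit-≢ (_ ∷ v) (suc i) {suc t} t≢i = bit-flipBit-≢ v i (t≢i ∘ cong suc)

AgreeOff : ∀ {n} → ℕ → Vec Bool n → Vec Bool n → Set
AgreeOff s v w = ∀ t → t ≢ s → bit v t ≡ bit w t

agreeOff-sym : ∀ {n s} {v w : Vec Bool n} → AgreeOff s v w → AgreeOff s w v
agreeOff-sym agree t t≢s = sym (agree t t≢s)

agreeOff-flipBit : ∀ {n} (v : Vec Bool n) (i : Fin n) → AgreeOff (toℕ i) v (flipBit v i)
agreeOff-flipBit v i t t≢i = sym (bit-flipBit-≢ v i t≢i)

agreeOff⇒≡⊎flipBit : ∀ {n} (i : Fin n) {v w : Vec Bool n} → AgreeOff (toℕ i) v w →
                     w ≡ v ⊎ w ≡ flipBit v i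
agreeOff⇒≡⊎flipBit i {v} {w} agree with bit w (toℕ i) Bool.≟ bit v (toℕ i)
... | yes same-at-i = inj₁ (bit-ext same)
  where
  same : ∀ t → bit w t ≡ bit v t
  same t with t ≟ toℕ i
  ... | yes refl = same-at-i
  ... | no t≢i   = sym (agree t t≢i)
... | no differ-at-i = inj₂ (bit-ext flipped)
  where
  flipped : ∀ t → bit w t ≡ bit (flipBit v i) t
  flipped t with t ≟ toℕ i
  ... | yes refl = trans (Bool.¬-not differ-at-i) (sym (bit-flipBit-≡ v i))
  ... | no t≢i   = trans (sym (agree t t≢i)) (sym (bit-flipBit-≢ v i t≢i))

-- The middle word is pinned down: at position s it agrees with b, everywhere else with a.
agreeOff-middle : ∀ {n s s'} {a b m m' : Vec Bool n} → s ≢ s' →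
                  AgreeOff s a m → AgreeOff s' m b → AgreeOff s a m' → AgreeOff s' m' b → m ≡ m'
agreeOff-middle {s = s} {m = m} {m'} s≢s' am mb am' m'b = bit-ext same
  where
  same : ∀ t → bit m t ≡ bit m' t
  same t with t ≟ s
  ... | yes refl = trans (mb t s≢s') (sym (m'b t s≢s'))
  ... | no t≢s   = trans (sym (am t t≢s)) (am' t t≢s)

parity : ∀ {n} → Vec Bool n → ℕ → Bool
parity w p = bit w p xor bit w (suc p)

parity-flipBit : ∀ {n} (w : Vec Bool n) (i : Fin n) {p} → toℕ i ≡ p ⊎ toℕ i ≡ suc p →
                 parity (flipBit w i) p ≡ not (parity w p)
parity-flipBit w i (inj₁ refl) = begin
  bit (flipBit w i) (toℕ i) xor bit (flipBit w i) (suc (toℕ i))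
    ≡⟨ cong₂ _xor_ (bit-flipBit-≡ w i) (bit-flipBit-≢ w i (m≢1+n+m (toℕ i) ∘ sym)) ⟩
  not (bit w (toℕ i)) xor bit w (suc (toℕ i))
    ≡⟨ sym (Bool.not-distribˡ-xor (bit w (toℕ i)) (bit w (suc (toℕ i)))) ⟩
  not (parity w (toℕ i)) ∎
  where open ≡-Reasoning
parity-flipBit w i {p} (inj₂ i≡1+p) = begin
  bit (flipBit w i) p xor bit (flipBit w i) (suc p)
    ≡⟨ cong₂ _xor_ (bit-flipBit-≢ w i (λ p≡i → m≢1+n+m p (trans p≡i i≡1+p)))
                   (subst (λ t → bit (flipBit w i) t ≡ not (bit w t)) i≡1+p (bit-flipBit-≡ w i)) ⟩
  bit w p xor not (bit w (suc p))
    ≡⟨ sym (Bool.not-distribʳ-xor (bit w p) (bit w (suc p))) ⟩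
  not (parity w p) ∎
  where open ≡-Reasoning

adjustParity : ∀ {n} (w : Vec Bool n) (i : Fin n) {p} → toℕ i ≡ p ⊎ toℕ i ≡ suc p → (c : Bool) →
               Σ (Vec Bool n) λ w' → parity w' p ≡ c × AgreeOff (toℕ i) w w'
adjustParity w i {p} i-in-pair c with parity w p Bool.≟ c
... | yes parity≡c = w , parity≡c , λ _ _ → refl
... | no  parity≢c = flipBit w i , parity-flipped , agreeOff-flipBit w i
  where
  parity-flipped : parity (flipBit w i) p ≡ c
  parity-flipped = trans (parity-flipBit w i i-in-pair)
                         (trans (cong not (Bool.¬-not parity≢c)) (Bool.not-involutive c))

length-map-++-map : ∀ {A B : Set} (f g : A → B) (xs : List A) →
                    length (map f xs ++ map g xs) ≡ 2 * length xs
length-map-++-map f g xs = begin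
  length (map f xs ++ map g xs)      ≡⟨ length-++ (map f xs) ⟩
  length (map f xs) + length (map g xs) ≡⟨ cong₂ _+_ (length-map f xs) (length-map g xs) ⟩
  length xs + length xs              ≡⟨ cong (length xs +_) (sym (+-identityʳ (length xs))) ⟩
  2 * length xs                      ∎
  where open ≡-Reasoning

allWords : (n : ℕ) → List (Vec Bool n)
allWords zero    = [ [] ]
allWords (suc n) = map (true ∷_) (allWords n) ++ map (false ∷_) (allWords n)

∈-allWords : ∀ {n} (w : Vec Bool n) → w ∈ allWords n
∈-allWords []          = here refl
∈-allWords (true ∷ w)  = ∈-++⁺ˡ (∈-map⁺ (true ∷_) (∈-allWords w))
∈-allWords (false ∷ w) = ∈-++⁺ʳ _ (∈-map⁺ (false ∷_) (∈-allWords w))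

length-allWords : ∀ n → length (allWords n) ≡ 2 ^ n
length-allWords zero    = refl
length-allWords (suc n) = trans (length-map-++-map _ _ (allWords n)) (cong (2 *_) (length-allWords n))

-- Correct only when p + 2 ≤ n; otherwise the list is empty.
wordsWithParity : (n p : ℕ) → Bool → List (Vec Bool n)
wordsWithParity (suc (suc n)) zero c =
  map (λ v → true ∷ not c ∷ v) (allWords n) ++ map (λ v → false ∷ c ∷ v) (allWords n)
wordsWithParity (suc n) (suc p) c =
  map (true ∷_) (wordsWithParity n p c) ++ map (false ∷_) (wordsWithParity n p c)
wordsWithParity _ _ _ = []

∈-wordsWithParity : ∀ {n} p (w : Vec Bool n) → 2 + p ≤ n → w ∈ wordsWithParity n p (parity w p)
∈-wordsWithParity zero (true ∷ b ∷ v) _ rewrite Bool.not-involutive b =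
  ∈-++⁺ˡ (∈-map⁺ (λ v → true ∷ b ∷ v) (∈-allWords v))
∈-wordsWithParity zero (false ∷ b ∷ v) _ =
  ∈-++⁺ʳ _ (∈-map⁺ (λ v → false ∷ b ∷ v) (∈-allWords v))
∈-wordsWithParity zero (_ ∷ []) (s≤s ())
∈-wordsWithParity {suc (suc _)} (suc p) (true ∷ w) (s≤s p+2≤n) =
  ∈-++⁺ˡ (∈-map⁺ (true ∷_) (∈-wordsWithParity p w p+2≤n))
∈-wordsWithParity {suc (suc _)} (suc p) (false ∷ w) (s≤s p+2≤n) =
  ∈-++⁺ʳ _ (∈-map⁺ (false ∷_) (∈-wordsWithParity p w p+2≤n))

length-wordsWithParity : ∀ n p c → 2 + p ≤ n → length (wordsWithParity n p c) ≡ 2 ^ (n ∸ 1)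
length-wordsWithParity (suc (suc n)) zero c _ =
  trans (length-map-++-map _ _ (allWords n)) (cong (2 *_) (length-allWords n))
length-wordsWithParity (suc zero) zero c (s≤s ())
length-wordsWithParity (suc (suc n)) (suc p) c (s≤s p+2≤n) =
  trans (length-map-++-map _ _ (wordsWithParity (suc n) p c))
        (cong (2 *_) (length-wordsWithParity (suc n) p c p+2≤n))

level : ∀ {r} → BFVertex r → ℕ
level (_ , l) = toℕ l

word : ∀ {r} → BFVertex r → Vec Bool r
word (w , _) = w

vertex-ext : ∀ {r} {x y : BFVertex r} → word x ≡ word y → level x ≡ level y → x ≡ y
vertex-ext {x = _ , _} {_ , _} refl e = cong (_ ,_) (toℕ-injective e)

_≟ᵥ_ : ∀ {r} → DecidableEquality (BFVertex r)
_≟ᵥ_ = Product.≡-dec (Vec.≡-dec Bool._≟_) Fin._≟_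

allVertices : (r : ℕ) → List (BFVertex r)
allVertices r = cartesianProduct (allWords r) (allFin (suc r))

∈-allVertices : ∀ {r} (x : BFVertex r) → x ∈ allVertices r
∈-allVertices (w , l) = ∈-cartesianProduct⁺ (∈-allWords w) (∈-allFin l)

link-level : ∀ {r x y} → Link r x y → level y ≡ suc (level x)
link-level (straight _ i) = cong suc (sym (toℕ-inject₁ i))
link-level (cross    _ i) = cong suc (sym (toℕ-inject₁ i))

link-level< : ∀ {r x y} → Link r x y → level x < r
link-level< {r} (straight _ i) = subst (_< r) (sym (toℕ-inject₁ i)) (toℕ<n i)
link-level< {r} (cross    _ i) = subst (_< r) (sym (toℕ-inject₁ i)) (toℕ<n i)

link-agreeOff : ∀ {r x y} → Link r x y → AgreeOff (level x) (word x) (word y)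
link-agreeOff (straight _ _) _ _ = refl
link-agreeOff (cross w i) =
  subst (λ s → AgreeOff s w (flipBit w i)) (sym (toℕ-inject₁ i)) (agreeOff-flipBit w i)

consecutive-levels : ∀ {r} (l l' : Fin (suc r)) → toℕ l' ≡ suc (toℕ l) →
                     Σ (Fin r) λ i → inject₁ i ≡ l × suc i ≡ l'
consecutive-levels {suc r} zero (suc zero) refl = zero , refl , refl
consecutive-levels {suc r} (suc l) (suc (suc l')) e with consecutive-levels l (suc l') (suc-injective e)
... | i , refl , refl = suc i , refl , refl
consecutive-levels {zero}  _       (suc ())         _
consecutive-levels {suc r} zero    (suc (suc _))    ()
consecutive-levels {suc r} (suc _) (suc zero)       ()
consecutive-levels         _       zero             ()

agreeOff⇒link : ∀ {r} {x y : BFVertex r} → level y ≡ suc (level x) →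
                AgreeOff (level x) (word x) (word y) → Link r x y
agreeOff⇒link {x = w , l} {w' , l'} e agree with consecutive-levels l l' e
... | i , refl , refl
    with agreeOff⇒≡⊎flipBit i {w} {w'} (subst (λ s → AgreeOff s w w') (toℕ-inject₁ i) agree)
...   | inj₁ refl = straight w i
...   | inj₂ refl = cross w i

link? : ∀ {r} (x y : BFVertex r) → Dec (Link r x y)
link? (w , l) (w' , zero) = no λ ()
link? (w , l) (w' , suc i) with inject₁ i Fin.≟ l
... | no  l≢i = no (l≢i ∘ link-source)
  where
  link-source : Link _ (w , l) (w' , suc i) → inject₁ i ≡ l
  link-source (straight _ _) = refl
  link-source (cross    _ _) = refl
... | yes refl with Vec.≡-dec Bool._≟_ w' w | Vec.≡-dec Bool._≟_ w' (flipBit w i)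
...   | yes refl | _        = yes (straight w i)
...   | no  _    | yes refl = yes (cross w i)
...   | no  w'≢w | no  w'≢w* = no λ { (straight _ _) → w'≢w refl ; (cross _ _) → w'≢w* refl }

adj? : ∀ {r} (x y : BFVertex r) → Dec (Adj r x y)
adj? x y = link? x y ⊎-dec link? y x

OneApart : ℕ → ℕ → Set
OneApart i j = j ≡ suc i ⊎ i ≡ suc j

oneApart-irrefl : ∀ {i} → ¬ OneApart i i
oneApart-irrefl (inj₁ ())
oneApart-irrefl (inj₂ ())

oneApart-not-two-apart : ∀ {i k} → OneApart i k → k ≢ suc (suc i)
oneApart-not-two-apart (inj₁ refl) ()
oneApart-not-two-apart (inj₂ refl) ()

oneApart-middle : ∀ {i j k} → OneApart i j → OneApart j k → k ≡ suc (suc i) → j ≡ suc i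
oneApart-middle (inj₁ refl) _           _  = refl
oneApart-middle (inj₂ refl) (inj₁ refl) ()
oneApart-middle (inj₂ refl) (inj₂ refl) ()

adj-level : ∀ {r x y} → Adj r x y → OneApart (level x) (level y)
adj-level (inj₁ xy) = inj₁ (link-level xy)
adj-level (inj₂ yx) = inj₂ (link-level yx)

adj-irrefl : ∀ {r x y} → Adj r x y → x ≢ y
adj-irrefl xy refl = oneApart-irrefl (adj-level xy)

rising-adj⇒link : ∀ {r x y} → Adj r x y → level y ≡ suc (level x) → Link r x y
rising-adj⇒link (inj₁ xy) _ = xy
rising-adj⇒link (inj₂ yx) e = ⊥-elim (m≢1+n+m _ (trans (link-level yx) (cong suc e)))

two-links-level : ∀ {r x m y} → Link r x m → Link r m y → level y ≡ suc (suc (level x))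
two-links-level xm my = trans (link-level my) (cong suc (link-level xm))

link-middle-unique : ∀ {r x m m' y} → Link r x m → Link r m y → Link r x m' → Link r m' y → m ≡ m'
link-middle-unique {x = x} {m} {m'} {y} xm my xm' m'y = vertex-ext words-equal (trans m-level (sym m'-level))
  where
  m-level : level m ≡ suc (level x)
  m-level = link-level xm
  m'-level : level m' ≡ suc (level x)
  m'-level = link-level xm'
  words-equal : word m ≡ word m'
  words-equal = agreeOff-middle {a = word x} {word y} (λ x≡m → m≢1+n+m _ (trans x≡m m-level))
                  (link-agreeOff xm) (link-agreeOff my) (link-agreeOff xm')
                  (subst (λ s → AgreeOff s (word m') (word y)) (trans m'-level (sym m-level)) (link-agreeOff m'y))

edgeOn-sym : ∀ {r u v x y} (q : Walk r u v) → EdgeOn x y q → EdgeOn y x q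
edgeOn-sym (_ ∷ _) (inj₁ first) = inj₁ (⊎-swap first)
edgeOn-sym (_ ∷ q) (inj₂ rest)  = inj₂ (edgeOn-sym q rest)

single-step-traverses : ∀ {r x y} (q : Walk r x y) → walkLength q ≤ 1 → x ≢ y → EdgeOn x y q
single-step-traverses []          _        x≢y = ⊥-elim (x≢y refl)
single-step-traverses (_ ∷ [])    _        _   = inj₁ (inj₁ (refl , refl))
single-step-traverses (_ ∷ _ ∷ _) (s≤s ()) _

ascending-walk-traverses : ∀ {r x m y} → Link r x m → Link r m y →
                           (q : Walk r x y) → walkLength q ≤ 2 → EdgeOn m y q
ascending-walk-traverses xm my [] _ = ⊥-elim (m≢1+n+m _ (two-links-level xm my))
ascending-walk-traverses xm my (s ∷ []) _ =
  ⊥-elim (oneApart-not-two-apart (adj-level s) (two-links-level xm my))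
ascending-walk-traverses {x = x} {m} xm my (_∷_ {w = m'} s (t ∷ [])) _ =
  inj₂ (inj₁ (inj₁ (m'≡m , refl)))
  where
  m'-level : level m' ≡ suc (level x)
  m'-level = oneApart-middle (adj-level s) (adj-level t) (two-links-level xm my)
  m'≡m : m' ≡ m
  m'≡m = sym (link-middle-unique xm my (rising-adj⇒link s m'-level)
                (rising-adj⇒link t (trans (two-links-level xm my) (cong suc (sym m'-level)))))
ascending-walk-traverses _ _ (_ ∷ _ ∷ _ ∷ _) (s≤s (s≤s ()))

descending-walk-traverses : ∀ {r x m y} → Link r x m → Link r m y →
                            (q : Walk r y x) → walkLength q ≤ 2 → EdgeOn x m q
descending-walk-traverses xm my [] _ = ⊥-elim (m≢1+n+m _ (two-links-level xm my))
descending-walk-traverses xm my (s ∷ []) _ =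
  ⊥-elim (oneApart-not-two-apart (⊎-swap (adj-level s)) (two-links-level xm my))
descending-walk-traverses {x = x} {m} xm my (_∷_ {w = m'} s (t ∷ [])) _ =
  inj₂ (inj₁ (inj₂ (m'≡m , refl)))
  where
  m'-level : level m' ≡ suc (level x)
  m'-level = oneApart-middle (⊎-swap (adj-level t)) (⊎-swap (adj-level s)) (two-links-level xm my)
  m'≡m : m' ≡ m
  m'≡m = sym (link-middle-unique xm my (rising-adj⇒link (⊎-swap t) m'-level)
                (rising-adj⇒link (⊎-swap s) (trans (two-links-level xm my) (cong suc (sym m'-level)))))
descending-walk-traverses _ _ (_ ∷ _ ∷ _ ∷ _) (s≤s (s≤s ()))

WalkWithin : ∀ r → ℕ → BFVertex r → BFVertex r → Set
WalkWithin r k u v = Σ (Walk r u v) λ q → walkLength q ≤ k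

walkWithin? : ∀ {r} k (u v : BFVertex r) → Dec (WalkWithin r k u v)
walkWithin? zero u v with u ≟ᵥ v
... | yes refl = yes ([] , z≤n)
... | no  u≢v  = no λ { ([] , _) → u≢v refl ; (_ ∷ _ , ()) }
walkWithin? {r} (suc k) u v
  with u ≟ᵥ v | any? (λ m → adj? u m ×-dec walkWithin? k m v) (allVertices r)
... | yes refl | _     = yes ([] , z≤n)
... | no  _    | yes found with satisfied found
...   | _ , s , q , q≤k = yes (s ∷ q , s≤s q≤k)
walkWithin? {r} (suc k) u v | no u≢v | no none = no λ
  { ([] , _)          → u≢v refl
  ; (s ∷ q , s≤s q≤k) → none (lose (∈-allVertices _) (s , q , q≤k)) }

ShortestWithin : ∀ r → ℕ → BFVertex r → BFVertex r → Set
ShortestWithin r k u v = Σ (Walk r u v) λ q → walkLength q ≤ k × IsShortest q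

shortestWithin? : ∀ {r} k (u v : BFVertex r) → ShortestWithin r k u v ⊎ ¬ WalkWithin r k u v
shortestWithin? zero u v with walkWithin? 0 u v
... | yes (q , q≤0) = inj₁ (q , q≤0 , λ _ → ≤-trans q≤0 z≤n)
... | no  none      = inj₂ none
shortestWithin? (suc k) u v with shortestWithin? k u v
... | inj₁ (q , q≤k , shortest) = inj₁ (q , m≤n⇒m≤1+n q≤k , shortest)
... | inj₂ none-within-k with walkWithin? (suc k) u v
...   | no  none            = inj₂ none
...   | yes (q , q≤1+k)     = inj₁ (q , q≤1+k , shortest)
  where
  shortest : IsShortest q
  shortest q' with walkLength q' ≤? k
  ... | yes q'≤k = ⊥-elim (none-within-k (q' , q'≤k))
  ... | no  q'≰k = ≤-trans q≤1+k (≰⇒> q'≰k)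

chosenPath : ∀ {r} (u v : BFVertex r) → .(DistLe2 r u v) → Walk r u v
chosenPath u v d≤2 with shortestWithin? 2 u v
... | inj₁ (q , _) = q
... | inj₂ none    = Irrelevant.⊥-elim (none d≤2)

chosenPath-shortest : ∀ {r} (u v : BFVertex r) (d≤2 : DistLe2 r u v) → IsShortest (chosenPath u v d≤2)
chosenPath-shortest u v d≤2 with shortestWithin? 2 u v
... | inj₁ (_ , _ , shortest) = shortest
... | inj₂ none               = ⊥-elim (none d≤2)

chosenPath-length : ∀ {r} (u v : BFVertex r) (d≤2 : DistLe2 r u v) →
                    walkLength (chosenPath u v d≤2) ≤ 2
chosenPath-length u v d≤2@(q , q≤2) = ≤-trans (chosenPath-shortest u v d≤2 q) q≤2

Covered : ∀ r → List (BFVertex r) → BFVertex r → BFVertex r → Set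
Covered r S x y =
  Σ (BFVertex r) λ u → Σ (u ∈ S) λ _ → Σ (BFVertex r) λ v → Σ (DistLe2 r u v) λ d≤2 →
  EdgeOn x y (chosenPath u v d≤2)

module _ {r} {S : List (BFVertex r)} where

  covered-sym : ∀ {x y} → Covered r S x y → Covered r S y x
  covered-sym (u , u∈S , v , d≤2 , on) = u , u∈S , v , d≤2 , edgeOn-sym (chosenPath u v d≤2) on

  covered-byEndpoint : ∀ {x y} → x ∈ S → Adj r x y → Covered r S x y
  covered-byEndpoint {x} {y} x∈S xy =
    x , x∈S , y , d≤2 ,
    single-step-traverses (chosenPath x y d≤2) (chosenPath-shortest x y d≤2 (xy ∷ [])) (adj-irrefl xy)
    where
    d≤2 : DistLe2 r x y
    d≤2 = xy ∷ [] , s≤s z≤n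

  covered-fromBelow : ∀ {u x y} → u ∈ S → Link r u x → Link r x y → Covered r S x y
  covered-fromBelow {u} {x} {y} u∈S ux xy =
    u , u∈S , y , d≤2 , ascending-walk-traverses ux xy (chosenPath u y d≤2) (chosenPath-length u y d≤2)
    where
    d≤2 : DistLe2 r u y
    d≤2 = inj₁ ux ∷ inj₁ xy ∷ [] , ≤-refl

  covered-fromAbove : ∀ {u x y} → u ∈ S → Link r x y → Link r y u → Covered r S x y
  covered-fromAbove {u} {x} {y} u∈S xy yu =
    u , u∈S , x , d≤2 , descending-walk-traverses xy yu (chosenPath u x d≤2) (chosenPath-length u x d≤2)
    where
    d≤2 : DistLe2 r u x
    d≤2 = inj₂ yu ∷ inj₂ xy ∷ [] , ≤-refl

-- The level min n r; only used with n ≤ r.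
cap : (r n : ℕ) → Fin (suc r)
cap _       zero    = zero
cap zero    (suc _) = zero
cap (suc r) (suc n) = suc (cap r n)

toℕ-cap : ∀ {r n} → n ≤ r → toℕ (cap r n) ≡ n
toℕ-cap {_}     {zero}  _         = refl
toℕ-cap {suc r} {suc n} (s≤s n≤r) = cong suc (toℕ-cap n≤r)

-- (p , c) stands for the vertices on level p + 1 whose bits p and p + 1 have parity c.
Layer : Set
Layer = ℕ × Bool

layerVertices : ∀ r → Layer → List (BFVertex r)
layerVertices r (p , c) = map (_, cap r (suc p)) (wordsWithParity r p c)

InRange : ℕ → List Layer → Set
InRange r L = ∀ {p c} → (p , c) ∈ L → 2 + p ≤ r

coverSet : ∀ r → List Layer → List (BFVertex r)
coverSet r L = deduplicate _≟ᵥ_ (concatMap (layerVertices r) L)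

length-concatMap : ∀ {A B : Set} (f : A → List B) {k} (xs : List A) →
                   (∀ {x} → x ∈ xs → length (f x) ≡ k) → length (concatMap f xs) ≡ length xs * k
length-concatMap f []       _          = refl
length-concatMap f (x ∷ xs) length-f≡k =
  trans (length-++ (f x)) (cong₂ _+_ (length-f≡k (here refl)) (length-concatMap f xs (length-f≡k ∘ there)))

length-coverSet : ∀ {r L} → InRange r L → length (coverSet r L) ≤ length L * 2 ^ (r ∸ 1)
length-coverSet {r} {L} inRange =
  ≤-trans (length-deduplicate _≟ᵥ_ (concatMap (layerVertices r) L))
          (≤-reflexive (length-concatMap (layerVertices r) L layer-size))
  where
  layer-size : ∀ {d} → d ∈ L → length (layerVertices r d) ≡ 2 ^ (r ∸ 1)
  layer-size {p , c} d∈L =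
    trans (length-map _ (wordsWithParity r p c)) (length-wordsWithParity r p c (inRange d∈L))

module _ {r} {L : List Layer} (inRange : InRange r L) where

  ∈-coverSet : ∀ {p c w l} → (p , c) ∈ L → parity w p ≡ c → toℕ l ≡ suc p →
               (w , l) ∈ coverSet r L
  ∈-coverSet {p} {w = w} {l} p∈L refl l≡1+p =
    ∈-deduplicate⁺ _≟ᵥ_ (∈-concatMap⁺ (layerVertices r) (lose p∈L (subst (λ l' → (w , l') ∈ _) cap≡l
      (∈-map⁺ (_, cap r (suc p)) (∈-wordsWithParity p w (inRange p∈L))))))
    where
    cap≡l : cap r (suc p) ≡ l
    cap≡l = toℕ-injective (trans (toℕ-cap (≤-trans (n≤1+n (suc p)) (inRange p∈L))) (sym l≡1+p))

  layerVertex-above : ∀ {p c} → (p , c) ∈ L → (y : BFVertex r) → level y ≡ p →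
                      Σ (BFVertex r) λ u → u ∈ coverSet r L × Link r y u
  layerVertex-above {p} {c} p∈L (w , l) l≡p =
    let w' , parity≡c , agree = adjustParity w i (inj₁ i≡p) c
    in (w' , cap r (suc p)) , ∈-coverSet p∈L parity≡c cap-level ,
       agreeOff⇒link (trans cap-level (cong suc (sym l≡p)))
                     (subst (λ s → AgreeOff s w w') (trans i≡p (sym l≡p)) agree)
    where
    p<r : p < r
    p<r = ≤-trans (n≤1+n (suc p)) (inRange p∈L)
    i : Fin r
    i = fromℕ< p<r
    i≡p : toℕ i ≡ p
    i≡p = toℕ-fromℕ< p<r
    cap-level : toℕ (cap r (suc p)) ≡ suc p
    cap-level = toℕ-cap p<r

  layerVertex-below : ∀ {p c} → (p , c) ∈ L → (x : BFVertex r) → level x ≡ suc (suc p) →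
                      Σ (BFVertex r) λ u → u ∈ coverSet r L × Link r u x
  layerVertex-below {p} {c} p∈L (w , l) l≡2+p =
    let w' , parity≡c , agree = adjustParity w i (inj₂ i≡1+p) c
    in (w' , cap r (suc p)) , ∈-coverSet p∈L parity≡c cap-level ,
       agreeOff⇒link (trans l≡2+p (cong suc (sym cap-level)))
                     (subst (λ s → AgreeOff s w' w) (trans i≡1+p (sym cap-level))
                            (agreeOff-sym {v = w} {w'} agree))
    where
    i : Fin r
    i = fromℕ< (inRange p∈L)
    i≡1+p : toℕ i ≡ suc p
    i≡1+p = toℕ-fromℕ< (inRange p∈L)
    cap-level : toℕ (cap r (suc p)) ≡ suc p
    cap-level = toℕ-cap (≤-trans (n≤1+n (suc p)) (inRange p∈L))

Full : List Layer → ℕ → Set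
Full L p = ∀ c → (p , c) ∈ L

-- The ways a layer can cover the links between levels l and l + 1.
data Served (L : List Layer) (l : ℕ) : Set where
  lowerEndInLayer : ∀ {p}   → Full L p    → l ≡ suc p       → Served L l
  upperEndInLayer : ∀ {p}   → Full L p    → l ≡ p           → Served L l
  belowLayer      : ∀ {p c} → (p , c) ∈ L → suc l ≡ p       → Served L l
  aboveLayer      : ∀ {p c} → (p , c) ∈ L → l ≡ suc (suc p) → Served L l

served-mono : ∀ {L M l} → (∀ {d} → d ∈ L → d ∈ M) → Served L l → Served M l
served-mono L⊆M (lowerEndInLayer full e) = lowerEndInLayer (L⊆M ∘ full) e
served-mono L⊆M (upperEndInLayer full e) = upperEndInLayer (L⊆M ∘ full) e
served-mono L⊆M (belowLayer p∈L e)       = belowLayer (L⊆M p∈L) e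
served-mono L⊆M (aboveLayer p∈L e)       = aboveLayer (L⊆M p∈L) e

module _ {r} {L : List Layer} (inRange : InRange r L) where

  link-covered : ∀ {x y} → Link r x y → Served L (level x) → Covered r (coverSet r L) x y
  link-covered {w , _} xy (lowerEndInLayer {p} full l≡1+p) =
    covered-byEndpoint (∈-coverSet inRange (full (parity w p)) refl l≡1+p) (inj₁ xy)
  link-covered {y = y@(w , _)} xy (upperEndInLayer {p} full l≡p) =
    covered-sym (covered-byEndpoint (∈-coverSet inRange (full (parity w p)) refl y-level) (inj₂ xy))
    where
    y-level : level y ≡ suc p
    y-level = trans (link-level xy) (cong suc l≡p)
  link-covered {y = y} xy (belowLayer p∈L 1+l≡p) =
    let _ , u∈S , yu = layerVertex-above inRange p∈L y (trans (link-level xy) 1+l≡p)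
    in covered-fromAbove u∈S xy yu
  link-covered {x} xy (aboveLayer p∈L l≡2+p) =
    let _ , u∈S , ux = layerVertex-below inRange p∈L x l≡2+p
    in covered-fromBelow u∈S ux xy

  coverSet-isCover : (∀ {l} → l < r → Served L l) → Is2SSPUnionCover r (coverSet r L)
  coverSet-isCover serves = record
    { path     = λ u v _ d≤2 → chosenPath u v d≤2
    ; shortest = λ u v _ → chosenPath-shortest u v
    ; covers   = covers
    }
    where
    covers : ∀ x y → Adj r x y → Covered r (coverSet r L) x y
    covers _ _ (inj₁ xy) = link-covered xy (serves (link-level< xy))
    covers _ _ (inj₂ yx) = covered-sym (link-covered yx (serves (link-level< yx)))

bothParities : ℕ → List Layer
bothParities p = (p , false) ∷ (p , true) ∷ []

full-bothParities : ∀ p → Full (bothParities p) p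
full-bothParities p false = here refl
full-bothParities p true  = there (here refl)

bothParities-inRange : ∀ {r p} → 2 + p ≤ r → InRange r (bothParities p)
bothParities-inRange p+2≤r (here refl)         = p+2≤r
bothParities-inRange p+2≤r (there (here refl)) = p+2≤r

bothParities-serves : ∀ q {l} → q ≤ l → l ≤ 3 + q → Served (bothParities (suc q)) l
bothParities-serves q {l} q≤l l≤3+q =
  subst (Served _) (m∸n+n≡m q≤l)
        (serves-offset (l ∸ q) (m≤n+o⇒m∸n≤o l q (subst (l ≤_) (+-comm 3 q) l≤3+q)))
  where
  serves-offset : ∀ d → d ≤ 3 → Served (bothParities (suc q)) (d + q)
  serves-offset 0 _ = belowLayer (here refl) refl
  serves-offset 1 _ = upperEndInLayer (full-bothParities (suc q)) refl
  serves-offset 2 _ = lowerEndInLayer (full-bothParities (suc q)) refl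
  serves-offset 3 _ = aboveLayer (here refl) refl
  serves-offset (suc (suc (suc (suc _)))) (s≤s (s≤s (s≤s ())))

inRange-++ : ∀ {r L M} → InRange r L → InRange r M → InRange r (L ++ M)
inRange-++ {L = L} inL inM d∈L++M = [ inL , inM ]′ (∈-++⁻ L d∈L++M)

inRange-mono : ∀ {r r' L} → r ≤ r' → InRange r L → InRange r' L
inRange-mono r≤r' inRange d∈L = ≤-trans (inRange d∈L) r≤r'

layers : ℕ → List Layer
layers 3 = bothParities 1
layers 4 = bothParities 1
layers 5 = bothParities 1 ++ [ 2 , false ]
layers 6 = (1 , false) ∷ (2 , false) ∷ (3 , false) ∷ []
layers (suc (suc (suc (suc r@(suc (suc (suc _))))))) = layers r ++ bothParities (suc r)
layers _ = []

layers-inRange : ∀ r → InRange r (layers r)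
layers-inRange 0 ()
layers-inRange 1 ()
layers-inRange 2 ()
layers-inRange 3 = bothParities-inRange ≤-refl
layers-inRange 4 = bothParities-inRange (n≤1+n 3)
layers-inRange 5 = inRange-++ (bothParities-inRange (m≤m+n 3 2)) λ { (here refl) → n≤1+n 4 }
layers-inRange 6 (here refl)                 = m≤m+n 3 3
layers-inRange 6 (there (here refl))         = m≤m+n 4 2
layers-inRange 6 (there (there (here refl))) = n≤1+n 5
layers-inRange (suc (suc (suc (suc r@(suc (suc (suc _))))))) =
  inRange-++ (inRange-mono (m≤n+m r 4) (layers-inRange r)) (bothParities-inRange (n≤1+n (3 + r)))

length-layers : ∀ r → length (layers r) ≤ ⌈ r /2⌉
length-layers 0 = z≤n
length-layers 1 = z≤n
length-layers 2 = z≤n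
length-layers 3 = ≤-refl
length-layers 4 = ≤-refl
length-layers 5 = ≤-refl
length-layers 6 = ≤-refl
length-layers (suc (suc (suc (suc r@(suc (suc (suc _))))))) = begin
  length (layers r ++ bothParities (suc r)) ≡⟨ length-++ (layers r) ⟩
  length (layers r) + 2                     ≡⟨ +-comm (length (layers r)) 2 ⟩
  2 + length (layers r)                     ≤⟨ +-monoʳ-≤ 2 (length-layers r) ⟩
  2 + ⌈ r /2⌉                               ∎
  where open Data.Nat.Properties.≤-Reasoning

layers-serve : ∀ r → 3 ≤ r → ∀ {l} → l < r → Served (layers r) l
layers-serve 3 _ l<3 = bothParities-serves 0 z≤n (m≤n⇒m≤1+n (m<1+n⇒m≤n l<3))
layers-serve 4 _ l<4 = bothParities-serves 0 z≤n (m<1+n⇒m≤n l<4)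
layers-serve 5 _ l<5 with m<1+n⇒m<n∨m≡n l<5
... | inj₁ l<4 = served-mono ∈-++⁺ˡ (layers-serve 4 (n≤1+n 3) l<4)
... | inj₂ refl = served-mono (∈-++⁺ʳ (bothParities 1)) (aboveLayer (here refl) refl)
layers-serve 6 _ {0} _ = belowLayer (here refl) refl
layers-serve 6 _ {1} _ = belowLayer (there (here refl)) refl
layers-serve 6 _ {2} _ = belowLayer (there (there (here refl))) refl
layers-serve 6 _ {3} _ = aboveLayer (here refl) refl
layers-serve 6 _ {4} _ = aboveLayer (there (here refl)) refl
layers-serve 6 _ {5} _ = aboveLayer (there (there (here refl))) refl
layers-serve 6 _ {suc (suc (suc (suc (suc (suc _)))))} (s≤s (s≤s (s≤s (s≤s (s≤s (s≤s ()))))))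
layers-serve (suc (suc (suc (suc r@(suc (suc (suc n))))))) _ {l} l<4+r =
  [ (λ l<r → served-mono ∈-++⁺ˡ (layers-serve r (m≤m+n 3 n) l<r)) ,
    (λ r≤l → served-mono (∈-++⁺ʳ (layers r)) (bothParities-serves r r≤l (m<1+n⇒m≤n l<4+r))) ]′
  (<-≤-connex l r)
layers-serve 0 ()
layers-serve 1 (s≤s ())
layers-serve 2 (s≤s (s≤s ()))

mainTheorem10 : (r : ℕ) → 3 ≤ r →
    Σ (List (BFVertex r)) λ S →
      Unique S × Is2SSPUnionCover r S × length S ≤ ⌈ r /2⌉ * 2 ^ (r ∸ 1)
mainTheorem10 r 3≤r =
  coverSet r (layers r) ,
  deduplicate-! _≟ᵥ_ (concatMap (layerVertices r) (layers r)) ,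
  coverSet-isCover (layers-inRange r) (layers-serve r 3≤r) ,
  ≤-trans (length-coverSet (layers-inRange r)) (*-monoˡ-≤ (2 ^ (r ∸ 1)) (length-layers r))
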